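{- Let $G$ be a $C_5$-free graph with $\Delta(G)\ge 1$, let $S$ be a maximum strong clique of $G$, and let $H$ be the subgraph of $G$ induced by the edge set $S$. If $H$ contains a $C_3$, then $\omega'_S(G)\le 4\Delta(G)-3$.
   Context: All graphs are finite and simple. $\Delta(G)$ is the maximum degree; $C_n$ is the cycle on $n$ vertices; $F$-free means containing no subgraph isomorphic to $F$. The distance between two edges of $G$ is the distance between the corresponding vertices in the line graph of $G$. A strong clique of $G$ is a set of edges with pairwise distance at most $2$; $\omega'_S(G)$ is the maximum size of a strong clique, and a maximum strong clique has this size. The subgraph induced by an edge set consists of these edges and their endpoints. -}

module Defs where

open import Data.Nat using (ℕ; zero; suc; _⊔_; _+_)
open import Data.Fin using (Fin; zero; suc) renaming (_<_ to _<ᶠ_)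
open import Data.Bool using (Bool; true; false; if_then_else_)
open import Data.List using (List; map; foldr; allFin; length)
open import Data.Nat.ListAction using (sum)
open import Data.List.Membership.Propositional using (_∈_)
open import Data.List.Relation.Unary.All using (All)
open import Data.List.Relation.Unary.Unique.Propositional using (Unique)
open import Data.Product using (Σ; ∃; _×_; _,_; proj₁; proj₂)
open import Data.Sum using (_⊎_)
open import Relation.Binary.PropositionalEquality using (_≡_; _≢_)
open import Relation.Nullary using (¬_)
open import Function.Definitions using (Injective)

record Graph (n : ℕ) : Set where
  field
    adj   : Fin n → Fin n → Bool
    sym   : ∀ u v → adj u v ≡ adj v u
    irrefl : ∀ u → adj u u ≡ false
open Graph public

module _ {n : ℕ} (G : Graph n) where

  Adj : Fin n → Fin n → Set
  Adj u v = adj G u v ≡ true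

  degree : Fin n → ℕ
  degree u = sum (map (λ v → if adj G u v then 1 else 0) (allFin n))

  maxDegree : ℕ
  maxDegree = foldr _⊔_ 0 (map degree (allFin n))

  -- An edge {u,v} is represented canonically as the pair (u , v) with u < v.
  Edge : Set
  Edge = Fin n × Fin n

  IsEdge : Edge → Set
  IsEdge (u , v) = (u <ᶠ v) × Adj u v

  Endpoint : Fin n → Edge → Set
  Endpoint x (u , v) = (x ≡ u) ⊎ (x ≡ v)

  LAdj : Edge → Edge → Set
  LAdj e f = (e ≢ f) × ∃ λ x → Endpoint x e × Endpoint x f

  Dist≤2 : Edge → Edge → Set
  Dist≤2 e f = (e ≡ f) ⊎ LAdj e f ⊎ (∃ λ g → IsEdge g × LAdj e g × LAdj g f)

  StrongClique : List Edge → Set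
  StrongClique S = Unique S × All IsEdge S × (∀ e f → e ∈ S → f ∈ S → Dist≤2 e f)

  MaxStrongClique : List Edge → Set
  MaxStrongClique S = StrongClique S × (∀ T → StrongClique T → length T ≤ length S)
    where open import Data.Nat using (_≤_)

  ContainsC5 : Set
  ContainsC5 = ∃ λ (c : Fin 5 → Fin n) → Injective _≡_ _≡_ c ×
    (Adj (c zero) (c (suc zero)) × Adj (c (suc zero)) (c (suc (suc zero))) ×
     Adj (c (suc (suc zero))) (c (suc (suc (suc zero)))) ×
     Adj (c (suc (suc (suc zero)))) (c (suc (suc (suc (suc zero))))) ×
     Adj (c (suc (suc (suc (suc zero))))) (c zero))

  C5Free : Set
  C5Free = ¬ ContainsC5

_∈ₑ_ : {n : ℕ} → Fin n × Fin n → List (Fin n × Fin n) → Set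
(u , v) ∈ₑ S = ((u , v) ∈ S) ⊎ ((v , u) ∈ S)

InducedHasC3 : {n : ℕ} → List (Fin n × Fin n) → Set
InducedHasC3 {n} S = ∃ λ (a : Fin n) → ∃ λ b → ∃ λ c →
  ((a , b) ∈ₑ S) × ((b , c) ∈ₑ S) × ((a , c) ∈ₑ S)

-- Let abc be the triangle in S. An edge of S avoiding a, b and c lies within distance 2 of each
-- side of the triangle, so for each side one of its endpoints is adjacent to a vertex of that side.
-- Since G has no C5, one endpoint, the hub, is then adjacent to two of a, b, c and the other to none,
-- and any two such edges, being within distance 2 of each other, have the same hub x. Hence every
-- edge of S meets a, b, c or x. Counting the edges at a, then the remaining ones at b (whose
-- neighbour a is already used), at c (a and b used) and at x gives |S| ≤ Δ + (Δ-1) + (Δ-2) + Δ.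

module Submission where

open import Defs
open import Data.Bool using (true; false; if_then_else_) renaming (_≟_ to _≟ᵇ_)
open import Data.Empty using (⊥; ⊥-elim)
open import Data.Fin using (Fin; zero; suc; _≟_)
open import Data.Fin.Patterns using (0F; 1F; 2F)
import Data.Fin.Properties as Fin
open import Data.List using (List; []; _∷_; _++_; length; map; filter; allFin; lookup)
open import Data.List.Properties using (length-map; length-++; length-removeAt′; filter-all; foldr-forcesᵇ)
open import Data.List.Membership.Propositional using (_∈_; _─_; find; lose)
open import Data.List.Membership.Propositional.Properties
  using (∈-allFin; ∈-filter⁺; ∈-filter⁻; ∈-map⁺; ∈-map⁻; ∈-++⁻; ∈-lookup)
open import Data.List.Relation.Binary.Disjoint.Propositional using (Disjoint)
open import Data.List.Relation.Binary.Subset.Propositional using (_⊆_)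
open import Data.List.Relation.Unary.All as All using (All; []; _∷_)
import Data.List.Relation.Unary.All.Properties as All
open import Data.List.Relation.Unary.AllPairs using ([]; _∷_)
open import Data.List.Relation.Unary.Any using (here; there; index; any?)
open import Data.List.Relation.Unary.Unique.Propositional using (Unique)
import Data.List.Relation.Unary.Unique.Propositional.Properties as Unique
open import Data.Nat using (ℕ; suc; _≤_; _+_; _*_; _∸_; z≤n; s≤s)
open import Data.Nat.ListAction using (sum)
open import Data.Nat.Properties
  using (≤-refl; ≤-reflexive; ≤-trans; +-mono-≤; +-suc; m⊔n≤o⇒m≤o; m⊔n≤o⇒n≤o; m+n≤o⇒m≤o∸n; module ≤-Reasoning)
open import Data.Nat.Tactic.RingSolver using (solve-∀)
open import Data.Product using (∃; ∃-syntax; _×_; _,_; proj₁; proj₂)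
open import Data.Sum as Sum using (_⊎_; inj₁; inj₂; [_,_])
open import Function using (_∘_; id)
open import Function.Definitions using (Injective)
open import Relation.Binary.PropositionalEquality as ≡
  using (_≡_; _≢_; refl; trans; cong; subst; ≢-sym)
open import Relation.Nullary using (¬_; yes; no; contradiction)
open import Relation.Nullary.Decidable using (_⊎-dec_; ¬?)
open import Relation.Unary using (Decidable)
open import Relation.Unary.Properties using (∁?)

module _ {A : Set} where

  ∈-─⁺ : ∀ {x y : A} {xs} (x∈xs : x ∈ xs) → y ∈ xs → y ≢ x → y ∈ xs ─ x∈xs
  ∈-─⁺ (here refl)  (here refl)  y≢x = contradiction refl y≢x
  ∈-─⁺ (here refl)  (there y∈xs) _   = y∈xs
  ∈-─⁺ (there _)    (here refl)  _   = here refl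
  ∈-─⁺ (there x∈xs) (there y∈xs) y≢x = there (∈-─⁺ x∈xs y∈xs y≢x)

  Unique⇒length≤ : ∀ {xs ys : List A} → Unique xs → xs ⊆ ys → length xs ≤ length ys
  Unique⇒length≤ [] _ = z≤n
  Unique⇒length≤ {x ∷ xs} {ys} (x∉xs ∷ xs-unique) x∷xs⊆ys = begin
    suc (length xs)          ≤⟨ s≤s (Unique⇒length≤ xs-unique xs⊆ys─x) ⟩
    suc (length (ys ─ x∈ys)) ≡⟨ length-removeAt′ ys (index x∈ys) ⟨
    length ys                ∎
    where
    open ≤-Reasoning
    x∈ys = x∷xs⊆ys (here refl)
    xs⊆ys─x : xs ⊆ ys ─ x∈ys
    xs⊆ys─x y∈xs = ∈-─⁺ x∈ys (x∷xs⊆ys (there y∈xs)) (λ y≡x → All.lookup x∉xs y∈xs (≡.sym y≡x))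

  lookup-injective : ∀ {xs : List A} → Unique xs → Injective _≡_ _≡_ (lookup xs)
  lookup-injective (_ ∷ _)     {zero}  {zero}  _  = refl
  lookup-injective (x∉xs ∷ _)  {zero}  {suc j} eq = contradiction eq (All.lookup x∉xs (∈-lookup j))
  lookup-injective (x∉xs ∷ _)  {suc i} {zero}  eq = contradiction (≡.sym eq) (All.lookup x∉xs (∈-lookup i))
  lookup-injective (_ ∷ xs-unique) {suc i} {suc j} eq = cong suc (lookup-injective xs-unique eq)

  map⁺-injectiveOn : ∀ {B : Set} {P : A → Set} {f : A → B} →
                     (∀ {x y} → P x → P y → f x ≡ f y → x ≡ y) →
                     ∀ {xs} → All P xs → Unique xs → Unique (map f xs)
  map⁺-injectiveOn inj []         []                 = []
  map⁺-injectiveOn inj (px ∷ pxs) (x∉xs ∷ xs-unique) =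
    All.map⁺ (All.zipWith (λ (py , x≢y) → x≢y ∘ inj px py) (pxs , x∉xs)) ∷ map⁺-injectiveOn inj pxs xs-unique

  length-filter-∁ : ∀ {P : A → Set} (P? : Decidable P) xs →
                    length xs ≡ length (filter P? xs) + length (filter (∁? P?) xs)
  length-filter-∁ P? []       = refl
  length-filter-∁ P? (x ∷ xs) with P? x
  ... | yes _ = cong suc (length-filter-∁ P? xs)
  ... | no  _ = trans (cong suc (length-filter-∁ P? xs)) (≡.sym (+-suc _ _))

sum≤4*Δ∸3 : ∀ {a b c x Δ} → a ≤ Δ → suc b ≤ Δ → suc (suc c) ≤ Δ → x ≤ Δ → a + (b + (c + x)) ≤ 4 * Δ ∸ 3
sum≤4*Δ∸3 {a} {b} {c} {x} {Δ} a≤Δ 1+b≤Δ 2+c≤Δ x≤Δ = m+n≤o⇒m≤o∸n (a + (b + (c + x))) (begin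
  a + (b + (c + x)) + 3           ≡⟨ shift-constants a b c x ⟩
  a + (suc b + (suc (suc c) + x)) ≤⟨ +-mono-≤ a≤Δ (+-mono-≤ 1+b≤Δ (+-mono-≤ 2+c≤Δ x≤Δ)) ⟩
  Δ + (Δ + (Δ + Δ))               ≡⟨ four-times Δ ⟩
  4 * Δ                           ∎)
  where
  open ≤-Reasoning
  shift-constants : ∀ a b c x → a + (b + (c + x)) + 3 ≡ a + (suc b + (suc (suc c) + x))
  shift-constants = solve-∀
  four-times : ∀ d → d + (d + (d + d)) ≡ 4 * d
  four-times = solve-∀

module GraphProperties {n : ℕ} (G : Graph n) where

  Adj-sym : ∀ {u v} → Adj G u v → Adj G v u
  Adj-sym {u} {v} u~v = trans (Graph.sym G v u) u~v

  Adj⇒≢ : ∀ {u v} → Adj G u v → u ≢ v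
  Adj⇒≢ {u} u~u refl with trans (≡.sym u~u) (Graph.irrefl G u)
  ... | ()

  neighbours : Fin n → List (Fin n)
  neighbours v = filter (λ w → adj G v w ≟ᵇ true) (allFin n)

  degree≡length-neighbours : ∀ v → degree G v ≡ length (neighbours v)
  degree≡length-neighbours v = count (allFin n)
    where
    count : ∀ ws → sum (map (λ w → if adj G v w then 1 else 0) ws)
                 ≡ length (filter (λ w → adj G v w ≟ᵇ true) ws)
    count []       = refl
    count (w ∷ ws) with adj G v w
    ... | true  = cong suc (count ws)
    ... | false = count ws

  degree≤maxDegree : ∀ v → degree G v ≤ maxDegree G
  degree≤maxDegree v = All.lookup degrees≤ (∈-map⁺ (degree G) (∈-allFin v))
    where
    degrees≤ : All (_≤ maxDegree G) (map (degree G) (allFin n))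
    degrees≤ = foldr-forcesᵇ (λ d e d⊔e≤ → m⊔n≤o⇒m≤o d e d⊔e≤ , m⊔n≤o⇒n≤o d e d⊔e≤) 0 _ ≤-refl

  length≤degree : ∀ v {ws} → Unique ws → (∀ {w} → w ∈ ws → Adj G v w) → length ws ≤ degree G v
  length≤degree v {ws} ws-unique ws-adj = begin
    length ws              ≤⟨ Unique⇒length≤ ws-unique (λ w∈ws → ∈-filter⁺ _ (∈-allFin _) (ws-adj w∈ws)) ⟩
    length (neighbours v)  ≡⟨ degree≡length-neighbours v ⟨
    degree G v             ∎
    where open ≤-Reasoning

  endpoint? : ∀ v → Decidable (Endpoint G v)
  endpoint? v (p , q) = (v ≟ p) ⊎-dec (v ≟ q)

  _⊆ᵛ_ : Edge G → Edge G → Set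
  e ⊆ᵛ f = ∀ {z} → Endpoint G z e → Endpoint G z f

  edge-≡ : ∀ {e f} → IsEdge G e → IsEdge G f → e ⊆ᵛ f → e ≡ f
  edge-≡ {p , q} {p′ , q′} (p<q , _) (p′<q′ , _) e⊆f with e⊆f (inj₁ refl) | e⊆f (inj₂ refl)
  ... | inj₁ refl | inj₁ refl = contradiction p<q (Fin.<-irrefl refl)
  ... | inj₁ refl | inj₂ refl = refl
  ... | inj₂ refl | inj₁ refl = contradiction p′<q′ (Fin.<-asym p<q)
  ... | inj₂ refl | inj₂ refl = contradiction p<q (Fin.<-irrefl refl)

  endpoints-adjacent : ∀ {e z z′} → IsEdge G e → Endpoint G z e → Endpoint G z′ e → z ≢ z′ → Adj G z z′
  endpoints-adjacent _         (inj₁ refl) (inj₁ refl) z≢z′ = contradiction refl z≢z′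
  endpoints-adjacent (_ , p~q) (inj₁ refl) (inj₂ refl) _    = p~q
  endpoints-adjacent (_ , p~q) (inj₂ refl) (inj₁ refl) _    = Adj-sym p~q
  endpoints-adjacent _         (inj₂ refl) (inj₂ refl) z≢z′ = contradiction refl z≢z′

  other : Fin n → Edge G → Fin n
  other v (p , q) with v ≟ p
  ... | yes _ = q
  ... | no  _ = p

  other-endpoint : ∀ v e → Endpoint G (other v e) e
  other-endpoint v (p , q) with v ≟ p
  ... | yes _ = inj₂ refl
  ... | no  _ = inj₁ refl

  endpoint-other : ∀ {v e} → Endpoint G v e → e ⊆ᵛ (v , other v e)
  endpoint-other {v} {p , q} v∈e z∈e with v ≟ p | v∈e
  ... | yes refl | _         = z∈e
  ... | no  v≢p  | inj₁ v≡p  = contradiction v≡p v≢p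
  ... | no  _    | inj₂ refl = Sum.swap z∈e

  adjacent-other : ∀ {v e} → IsEdge G e → Endpoint G v e → Adj G v (other v e)
  adjacent-other {v} {p , q} (_ , p~q) v∈e with v ≟ p | v∈e
  ... | yes refl | _         = p~q
  ... | no  v≢p  | inj₁ v≡p  = contradiction v≡p v≢p
  ... | no  _    | inj₂ refl = Adj-sym p~q

  other-injective : ∀ v {e f} → IsEdge G e × Endpoint G v e → IsEdge G f × Endpoint G v f →
                    other v e ≡ other v f → e ≡ f
  other-injective v {e} {f} (e-edge , v∈e) (f-edge , v∈f) same-other = edge-≡ e-edge f-edge e⊆f
    where
    e⊆f : e ⊆ᵛ f
    e⊆f z∈e with endpoint-other v∈e z∈e
    ... | inj₁ refl = v∈f
    ... | inj₂ refl = subst (λ w → Endpoint G w f) (≡.sym same-other) (other-endpoint v f)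

  length-edgesAt≤degree : ∀ v {E L} → Unique E → (∀ {w} → w ∈ E → Adj G v w) →
                          Unique L → All (IsEdge G) L → (∀ {e w} → e ∈ L → w ∈ E → ¬ Endpoint G w e) →
                          length E + length (filter (endpoint? v) L) ≤ degree G v
  length-edgesAt≤degree v {E} {L} E-unique E-adj L-unique L-edges L-avoids-E = begin
    length E + length Lᵥ                 ≡⟨ cong (length E +_) (length-map (other v) Lᵥ) ⟨
    length E + length (map (other v) Lᵥ) ≡⟨ length-++ E ⟨
    length (E ++ map (other v) Lᵥ)       ≤⟨ length≤degree v (Unique.++⁺ E-unique others-unique disjoint) adjacent ⟩
    degree G v                           ∎
    where
    open ≤-Reasoning
    Lᵥ = filter (endpoint? v) L

    Lᵥ-at-v : ∀ {e} → e ∈ Lᵥ → IsEdge G e × Endpoint G v e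
    Lᵥ-at-v e∈Lᵥ = let e∈L , v∈e = ∈-filter⁻ (endpoint? v) e∈Lᵥ in All.lookup L-edges e∈L , v∈e

    others-unique : Unique (map (other v) Lᵥ)
    others-unique = map⁺-injectiveOn (other-injective v) (All.tabulate Lᵥ-at-v)
                                     (Unique.filter⁺ (endpoint? v) L-unique)

    disjoint : Disjoint E (map (other v) Lᵥ)
    disjoint (w∈E , w∈others) with ∈-map⁻ (other v) w∈others
    ... | e , e∈Lᵥ , refl = L-avoids-E (proj₁ (∈-filter⁻ (endpoint? v) e∈Lᵥ)) w∈E (other-endpoint v e)

    adjacent : ∀ {w} → w ∈ E ++ map (other v) Lᵥ → Adj G v w
    adjacent w∈ws with ∈-++⁻ E w∈ws
    ... | inj₁ w∈E      = E-adj w∈E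
    ... | inj₂ w∈others with ∈-map⁻ (other v) w∈others
    ...   | e , e∈Lᵥ , refl = let e-edge , v∈e = Lᵥ-at-v e∈Lᵥ in adjacent-other e-edge v∈e

  ∈ₑ⇒Adj : ∀ {S u v} → All (IsEdge G) S → (u , v) ∈ₑ S → Adj G u v
  ∈ₑ⇒Adj S-edges (inj₁ uv∈S) = proj₂ (All.lookup S-edges uv∈S)
  ∈ₑ⇒Adj S-edges (inj₂ vu∈S) = Adj-sym (proj₂ (All.lookup S-edges vu∈S))

  ∈ₑ⇒⊆ᵛ : ∀ {S u v} → (u , v) ∈ₑ S → ∃[ e ] e ∈ S × e ⊆ᵛ (u , v)
  ∈ₑ⇒⊆ᵛ (inj₁ uv∈S) = _ , uv∈S , id
  ∈ₑ⇒⊆ᵛ (inj₂ vu∈S) = _ , vu∈S , Sum.swap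

  Touch : Edge G → Edge G → Set
  Touch e f = ∃[ z ] ∃[ z′ ] Endpoint G z e × Endpoint G z′ f × (z ≡ z′ ⊎ Adj G z z′)

  Touch-mono : ∀ {e e′ f f′} → e ⊆ᵛ e′ → f ⊆ᵛ f′ → Touch e f → Touch e′ f′
  Touch-mono e⊆e′ f⊆f′ (z , z′ , z∈e , z′∈f , link) = z , z′ , e⊆e′ z∈e , f⊆f′ z′∈f , link

  Dist≤2⇒Touch : ∀ {e f} → Dist≤2 G e f → Touch e f
  Dist≤2⇒Touch {p , q} (inj₁ refl) = p , p , inj₁ refl , inj₁ refl , inj₁ refl
  Dist≤2⇒Touch (inj₂ (inj₁ (_ , z , z∈e , z∈f))) = z , z , z∈e , z∈f , inj₁ refl
  Dist≤2⇒Touch (inj₂ (inj₂ (_ , g-edge , (_ , z , z∈e , z∈g) , (_ , z′ , z′∈g , z′∈f)))) with z ≟ z′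
  ... | yes z≡z′ = z , z′ , z∈e , z′∈f , inj₁ z≡z′
  ... | no  z≢z′ = z , z′ , z∈e , z′∈f , inj₂ (endpoints-adjacent g-edge z∈g z′∈g z≢z′)

  no-C5 : C5Free G → ∀ v₀ v₁ v₂ v₃ v₄ → v₀ ≢ v₂ → v₀ ≢ v₃ → v₁ ≢ v₃ → v₁ ≢ v₄ → v₂ ≢ v₄ →
          Adj G v₀ v₁ → Adj G v₁ v₂ → Adj G v₂ v₃ → Adj G v₃ v₄ → Adj G v₄ v₀ → ⊥
  no-C5 C5-free v₀ v₁ v₂ v₃ v₄ v₀≢v₂ v₀≢v₃ v₁≢v₃ v₁≢v₄ v₂≢v₄ v₀~v₁ v₁~v₂ v₂~v₃ v₃~v₄ v₄~v₀ =
    C5-free (lookup cycle , lookup-injective distinct , v₀~v₁ , v₁~v₂ , v₂~v₃ , v₃~v₄ , v₄~v₀)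
    where
    cycle = v₀ ∷ v₁ ∷ v₂ ∷ v₃ ∷ v₄ ∷ []
    distinct : Unique cycle
    distinct = (Adj⇒≢ v₀~v₁ ∷ v₀≢v₂ ∷ v₀≢v₃ ∷ ≢-sym (Adj⇒≢ v₄~v₀) ∷ [])
             ∷ (Adj⇒≢ v₁~v₂ ∷ v₁≢v₃ ∷ v₁≢v₄ ∷ [])
             ∷ (Adj⇒≢ v₂~v₃ ∷ v₂≢v₄ ∷ [])
             ∷ (Adj⇒≢ v₃~v₄ ∷ [])
             ∷ [] ∷ []

third : Fin 3 → Fin 3 → Fin 3
third 0F 1F = 2F
third 1F 0F = 2F
third 0F 2F = 1F
third 2F 0F = 1F
third 1F 2F = 0F
third 2F 1F = 0F
third _  _  = 0F  -- junk: i ≡ j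

third≢ˡ : ∀ {i j} → i ≢ j → third i j ≢ i
third≢ˡ {0F} {0F} i≢j = contradiction refl i≢j
third≢ˡ {1F} {1F} i≢j = contradiction refl i≢j
third≢ˡ {2F} {2F} i≢j = contradiction refl i≢j
third≢ˡ {0F} {1F} _ ()
third≢ˡ {0F} {2F} _ ()
third≢ˡ {1F} {0F} _ ()
third≢ˡ {1F} {2F} _ ()
third≢ˡ {2F} {0F} _ ()
third≢ˡ {2F} {1F} _ ()

third≢ʳ : ∀ {i j} → i ≢ j → third i j ≢ j
third≢ʳ {0F} {0F} i≢j = contradiction refl i≢j
third≢ʳ {1F} {1F} i≢j = contradiction refl i≢j
third≢ʳ {2F} {2F} i≢j = contradiction refl i≢j
third≢ʳ {0F} {1F} _ ()
third≢ʳ {0F} {2F} _ ()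
third≢ʳ {1F} {0F} _ ()
third≢ʳ {1F} {2F} _ ()
third≢ʳ {2F} {0F} _ ()
third≢ʳ {2F} {1F} _ ()

third-cover : ∀ {i j} k → i ≢ j → k ≡ i ⊎ k ≡ j ⊎ k ≡ third i j
third-cover {0F} {0F} _  i≢j = contradiction refl i≢j
third-cover {1F} {1F} _  i≢j = contradiction refl i≢j
third-cover {2F} {2F} _  i≢j = contradiction refl i≢j
third-cover {0F} {1F} 0F _ = inj₁ refl
third-cover {0F} {1F} 1F _ = inj₂ (inj₁ refl)
third-cover {0F} {1F} 2F _ = inj₂ (inj₂ refl)
third-cover {0F} {2F} 0F _ = inj₁ refl
third-cover {0F} {2F} 1F _ = inj₂ (inj₂ refl)
third-cover {0F} {2F} 2F _ = inj₂ (inj₁ refl)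
third-cover {1F} {0F} 0F _ = inj₂ (inj₁ refl)
third-cover {1F} {0F} 1F _ = inj₁ refl
third-cover {1F} {0F} 2F _ = inj₂ (inj₂ refl)
third-cover {1F} {2F} 0F _ = inj₂ (inj₂ refl)
third-cover {1F} {2F} 1F _ = inj₁ refl
third-cover {1F} {2F} 2F _ = inj₂ (inj₁ refl)
third-cover {2F} {0F} 0F _ = inj₂ (inj₁ refl)
third-cover {2F} {0F} 1F _ = inj₂ (inj₂ refl)
third-cover {2F} {0F} 2F _ = inj₁ refl
third-cover {2F} {1F} 0F _ = inj₂ (inj₂ refl)
third-cover {2F} {1F} 1F _ = inj₂ (inj₁ refl)
third-cover {2F} {1F} 2F _ = inj₁ refl

module Triangle {n : ℕ} {G : Graph n} (C5-free : C5Free G)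
                (t : Fin 3 → Fin n) (t-adj : ∀ {i j} → i ≢ j → Adj G (t i) (t j)) where

  open GraphProperties G

  t-injective : ∀ {i j} → i ≢ j → t i ≢ t j
  t-injective = Adj⇒≢ ∘ t-adj

  OffT : Fin n → Set
  OffT w = ∀ k → w ≢ t k

  Blind : Fin n → Set
  Blind y = ∀ k → ¬ Adj G y (t k)

  Sees₂ : Fin n → Set
  Sees₂ x = ∃[ i ] ∃[ j ] i ≢ j × Adj G x (t i) × Adj G x (t j)

  Blind⇒≢ : ∀ {x y k} → Blind y → Adj G x (t k) → x ≢ y
  Blind⇒≢ {k = k} y-blind x~k refl = y-blind k x~k

  no-cross : ∀ {w w′ p q} → OffT w → OffT w′ → Adj G w w′ → p ≢ q →
             Adj G w (t p) → Adj G w′ (t q) → ⊥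
  no-cross {w} {w′} {p} {q} w-off w′-off w~w′ p≢q w~p w′~q =
    no-C5 C5-free w (t p) (t (third p q)) (t q) w′
      (w-off _) (w-off q) (t-injective p≢q) (≢-sym (w′-off p)) (≢-sym (w′-off _))
      w~p (t-adj (≢-sym (third≢ˡ p≢q))) (t-adj (third≢ʳ p≢q)) (Adj-sym w′~q) (Adj-sym w~w′)

  no-common-neighbour : ∀ {x x′ w p q} → OffT x → OffT x′ → OffT w → x ≢ x′ → p ≢ q →
                        Adj G x w → Adj G w x′ → Adj G x′ (t p) → Adj G x (t q) → ⊥
  no-common-neighbour {x} {x′} {w} {p} {q} x-off x′-off w-off x≢x′ p≢q x~w w~x′ x′~p x~q =
    no-C5 C5-free x w x′ (t p) (t q) x≢x′ (x-off p) (w-off p) (w-off q) (x′-off q)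
      x~w w~x′ x′~p (t-adj p≢q) (Adj-sym x~q)

  TouchesEverySide : Edge G → Set
  TouchesEverySide e = ∀ k → ∃[ z ] Endpoint G z e × ∃[ i ] i ≢ k × Adj G z (t i)

  record Hub (x y : Fin n) : Set where
    field
      x-off   : OffT x
      y-off   : OffT y
      x~y     : Adj G x y
      y-blind : Blind y
      x-sees₂ : Sees₂ x
  open Hub

  hub : ∀ {x y k} → OffT x → OffT y → Adj G x y → Adj G x (t k) → TouchesEverySide (x , y) → Hub x y
  hub {x} {y} {k} x-off y-off x~y x~k touches = record
    { x-off = x-off ; y-off = y-off ; x~y = x~y ; y-blind = blind ; x-sees₂ = sees-two }
    where
    blind : Blind y
    blind k′ y~k′ with k′ ≟ k
    ... | no k′≢k = no-cross x-off y-off x~y (≢-sym k′≢k) x~k y~k′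
    ... | yes refl with touches k
    ...   | _ , inj₁ refl , i , i≢k , x~i = no-cross y-off x-off (Adj-sym x~y) (≢-sym i≢k) y~k′ x~i
    ...   | _ , inj₂ refl , i , i≢k , y~i = no-cross x-off y-off x~y (≢-sym i≢k) x~k y~i
    sees-two : Sees₂ x
    sees-two with touches k
    ... | _ , inj₁ refl , i , i≢k , x~i = k , i , ≢-sym i≢k , x~k , x~i
    ... | _ , inj₂ refl , i , _   , y~i = ⊥-elim (blind i y~i)

  hub-of-edge : ∀ {u v} → OffT u → OffT v → Adj G u v → TouchesEverySide (u , v) → Hub u v ⊎ Hub v u
  hub-of-edge u-off v-off u~v touches with touches 0F
  ... | _ , inj₁ refl , _ , _ , u~i = inj₁ (hub u-off v-off u~v u~i touches)
  ... | _ , inj₂ refl , _ , _ , v~i = inj₂ (hub v-off u-off (Adj-sym u~v) v~i touches′)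
    where
    touches′ : TouchesEverySide (_ , _)
    touches′ k = let z , z∈e , seen = touches k in z , Sum.swap z∈e , seen

  shared : ∀ {x x′} → Sees₂ x → Sees₂ x′ →
           ∃[ p ] ∃[ q ] ∃[ r ] p ≢ q × p ≢ r ×
             Adj G x (t p) × Adj G x (t q) × Adj G x′ (t p) × Adj G x′ (t r)
  shared (i , j , i≢j , x~i , x~j) (i′ , j′ , i′≢j′ , x′~i′ , x′~j′) with third-cover i′ i≢j
  ... | inj₁ refl        = i , j , j′ , i≢j , i′≢j′ , x~i , x~j , x′~i′ , x′~j′
  ... | inj₂ (inj₁ refl) = j , i , j′ , ≢-sym i≢j , i′≢j′ , x~j , x~i , x′~i′ , x′~j′
  ... | inj₂ (inj₂ i′≡third) with third-cover j′ i≢j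
  ...   | inj₁ refl        = i , j , i′ , i≢j , ≢-sym i′≢j′ , x~i , x~j , x′~j′ , x′~i′
  ...   | inj₂ (inj₁ refl) = j , i , i′ , ≢-sym i≢j , ≢-sym i′≢j′ , x~j , x~i , x′~j′ , x′~i′
  ...   | inj₂ (inj₂ j′≡third) = contradiction (trans i′≡third (≡.sym j′≡third)) i′≢j′

  no-touch : ∀ {x y x′ y′ p q} → Hub x y → Hub x′ y′ → x ≢ x′ → p ≢ q →
             Adj G x (t p) → Adj G x (t q) → Adj G x′ (t p) → Adj G x′ (t q) → ¬ Touch (x , y) (x′ , y′)
  no-touch h h′ x≢x′ p≢q x~p x~q x′~p x′~q (_ , _ , inj₁ refl , inj₁ refl , inj₁ refl) = x≢x′ refl
  no-touch h h′ x≢x′ p≢q x~p x~q x′~p x′~q (_ , _ , inj₁ refl , inj₂ refl , inj₁ refl) = y-blind h′ _ x~p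
  no-touch h h′ x≢x′ p≢q x~p x~q x′~p x′~q (_ , _ , inj₂ refl , inj₁ refl , inj₁ refl) = y-blind h _ x′~p
  no-touch h h′ x≢x′ p≢q x~p x~q x′~p x′~q (_ , _ , inj₂ refl , inj₂ refl , inj₁ refl) =
    no-common-neighbour (x-off h) (x-off h′) (y-off h) x≢x′ p≢q (x~y h) (Adj-sym (x~y h′)) x′~p x~q
  no-touch h h′ x≢x′ p≢q x~p x~q x′~p x′~q (_ , _ , inj₁ refl , inj₂ refl , inj₂ x~y′) =
    no-common-neighbour (x-off h) (x-off h′) (y-off h′) x≢x′ p≢q x~y′ (Adj-sym (x~y h′)) x′~p x~q
  no-touch h h′ x≢x′ p≢q x~p x~q x′~p x′~q (_ , _ , inj₂ refl , inj₁ refl , inj₂ y~x′) =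
    no-common-neighbour (x-off h) (x-off h′) (y-off h) x≢x′ p≢q (x~y h) y~x′ x′~p x~q
  no-touch {x} {_} {x′} {p = p} {q} h h′ _ p≢q x~p x~q x′~p x′~q (_ , _ , inj₁ refl , inj₁ refl , inj₂ x~x′) =
    no-C5 C5-free x x′ (t p) (t (third p q)) (t q)
      (x-off h p) (x-off h _) (x-off h′ _) (x-off h′ q) (t-injective p≢q)
      x~x′ x′~p (t-adj (≢-sym (third≢ˡ p≢q))) (t-adj (third≢ʳ p≢q)) (Adj-sym x~q)
  no-touch {x} {y} {x′} {y′} {p} h h′ x≢x′ _ x~p _ x′~p _ (_ , _ , inj₂ refl , inj₂ refl , inj₂ y~y′) =
    no-C5 C5-free x y y′ x′ (t p)
      (Blind⇒≢ (y-blind h′) x~p) x≢x′ (≢-sym (Blind⇒≢ (y-blind h) x′~p)) (y-off h p) (y-off h′ p)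
      (x~y h) y~y′ (Adj-sym (x~y h′)) x′~p (Adj-sym x~p)

  hub-unique : ∀ {x y x′ y′} → Hub x y → Hub x′ y′ → Touch (x , y) (x′ , y′) → x ≡ x′
  hub-unique {x} {_} {x′} h h′ touch with x ≟ x′
  ... | yes x≡x′ = x≡x′
  ... | no  x≢x′ with shared (x-sees₂ h) (x-sees₂ h′)
  ...   | p , q , r , p≢q , p≢r , x~p , x~q , x′~p , x′~r with q ≟ r
  ...     | yes refl = ⊥-elim (no-touch h h′ x≢x′ p≢q x~p x~q x′~p x′~r touch)
  ...     | no  q≢r  = ⊥-elim (no-C5 C5-free x (t q) (t r) x′ (t p)
                          (x-off h r) x≢x′ (≢-sym (x-off h′ q)) (t-injective (≢-sym p≢q)) (t-injective (≢-sym p≢r))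
                          x~q (t-adj q≢r) (Adj-sym x′~r) x′~p (Adj-sym x~p))

  Avoids : Edge G → Set
  Avoids e = ∀ k → ¬ Endpoint G (t k) e

  Avoids⇒OffT : ∀ {u v} → Avoids (u , v) → OffT u × OffT v
  Avoids⇒OffT avoids = (λ k u≡t → avoids k (inj₁ (≡.sym u≡t))) , (λ k v≡t → avoids k (inj₂ (≡.sym v≡t)))

  Opposite : Fin 3 → Edge G → Set
  Opposite k e = ∀ {z} → Endpoint G z e → ∃[ i ] i ≢ k × z ≡ t i

  module _ {S : List (Edge G)} (S-edges : All (IsEdge G) S) (S-dist : ∀ e f → e ∈ S → f ∈ S → Dist≤2 G e f)
           (sides : ∀ k → ∃[ e ] e ∈ S × Opposite k e) where

    touches-every-side : ∀ {e} → e ∈ S → Avoids e → TouchesEverySide e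
    touches-every-side e∈S e-avoids k with sides k
    ... | _ , o∈S , opposite with Dist≤2⇒Touch (S-dist _ _ e∈S o∈S)
    ...   | z , _ , z∈e , z′∈o , link with opposite z′∈o | link
    ...     | i , _   , refl | inj₁ refl = ⊥-elim (e-avoids i z∈e)
    ...     | i , i≢k , refl | inj₂ z~i  = z , z∈e , i , i≢k , z~i

    HubOf : Edge G → Fin n → Set
    HubOf e x = ∃[ y ] Hub x y × Endpoint G x e × e ⊆ᵛ (x , y)

    hub-of : ∀ {e} → e ∈ S → Avoids e → ∃ (HubOf e)
    hub-of {u , v} e∈S e-avoids with Avoids⇒OffT e-avoids | All.lookup S-edges e∈S
    ... | u-off , v-off | _ , u~v with hub-of-edge u-off v-off u~v (touches-every-side e∈S e-avoids)
    ...   | inj₁ h = u , v , h , inj₁ refl , id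
    ...   | inj₂ h = v , u , h , inj₂ refl , Sum.swap

    HubOf-unique : ∀ {e f x x′} → e ∈ S → f ∈ S → HubOf e x → HubOf f x′ → x ≡ x′
    HubOf-unique e∈S f∈S (_ , h , _ , e⊆) (_ , h′ , _ , f⊆) =
      hub-unique h h′ (Touch-mono e⊆ f⊆ (Dist≤2⇒Touch (S-dist _ _ e∈S f∈S)))

    triangle-hub : ∃[ x ] ∀ {e} → e ∈ S → Avoids e → Endpoint G x e
    triangle-hub with any? (λ e → Fin.all? (λ k → ¬? (endpoint? (t k) e))) S
    ... | no  none = t 0F , λ e∈S e-avoids → contradiction (lose e∈S e-avoids) none
    ... | yes some with find some
    ...   | _ , e₀∈S , e₀-avoids with hub-of e₀∈S e₀-avoids
    ...     | x , x-hub = x , x-at-every-avoiding-edge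
      where
      x-at-every-avoiding-edge : ∀ {e} → e ∈ S → Avoids e → Endpoint G x e
      x-at-every-avoiding-edge e∈S e-avoids with hub-of e∈S e-avoids
      ... | x′ , x′-hub@(_ , _ , x′∈e , _) =
        subst (λ w → Endpoint G w _) (≡.sym (HubOf-unique e₀∈S e∈S x-hub x′-hub)) x′∈e

module _ {n : ℕ} (G : Graph n) where
  open GraphProperties G

  triangle-cover-bound : ∀ {S a b c x} → Unique S → All (IsEdge G) S → Adj G a b → Adj G a c → Adj G b c →
                         (∀ {e} → e ∈ S → ¬ Endpoint G a e → ¬ Endpoint G b e → ¬ Endpoint G c e → Endpoint G x e) →
                         length S ≤ 4 * maxDegree G ∸ 3
  triangle-cover-bound {S} {a} {b} {c} {x} S-unique S-edges a~b a~c b~c at-x =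
    ≤-trans (≤-reflexive partition) (sum≤4*Δ∸3 A≤Δ 1+B≤Δ 2+C≤Δ X≤Δ)
    where
    open ≤-Reasoning
    Δ = maxDegree G
    S₁ = filter (∁? (endpoint? a)) S
    S₂ = filter (∁? (endpoint? b)) S₁
    S₃ = filter (∁? (endpoint? c)) S₂
    A = length (filter (endpoint? a) S)
    B = length (filter (endpoint? b) S₁)
    C = length (filter (endpoint? c) S₂)
    X = length (filter (endpoint? x) S₃)

    S₁-unique = Unique.filter⁺ (∁? (endpoint? a)) S-unique
    S₂-unique = Unique.filter⁺ (∁? (endpoint? b)) S₁-unique
    S₃-unique = Unique.filter⁺ (∁? (endpoint? c)) S₂-unique
    S₁-edges = All.filter⁺ (∁? (endpoint? a)) S-edges
    S₂-edges = All.filter⁺ (∁? (endpoint? b)) S₁-edges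
    S₃-edges = All.filter⁺ (∁? (endpoint? c)) S₂-edges

    S₁⊆ : ∀ {e} → e ∈ S₁ → e ∈ S × ¬ Endpoint G a e
    S₁⊆ = ∈-filter⁻ (∁? (endpoint? a))
    S₂⊆ : ∀ {e} → e ∈ S₂ → e ∈ S₁ × ¬ Endpoint G b e
    S₂⊆ = ∈-filter⁻ (∁? (endpoint? b))
    S₃⊆ : ∀ {e} → e ∈ S₃ → e ∈ S₂ × ¬ Endpoint G c e
    S₃⊆ = ∈-filter⁻ (∁? (endpoint? c))

    S₃-at-x : All (Endpoint G x) S₃
    S₃-at-x = All.tabulate λ e∈S₃ →
      let e∈S₂ , ¬c = S₃⊆ e∈S₃ ; e∈S₁ , ¬b = S₂⊆ e∈S₂ ; e∈S , ¬a = S₁⊆ e∈S₁ in at-x e∈S ¬a ¬b ¬c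

    partition : length S ≡ A + (B + (C + X))
    partition = begin-equality
      length S                  ≡⟨ length-filter-∁ (endpoint? a) S ⟩
      A + length S₁             ≡⟨ cong (A +_) (length-filter-∁ (endpoint? b) S₁) ⟩
      A + (B + length S₂)       ≡⟨ cong (λ m → A + (B + m)) (length-filter-∁ (endpoint? c) S₂) ⟩
      A + (B + (C + length S₃)) ≡⟨ cong (λ m → A + (B + (C + length m))) (filter-all (endpoint? x) S₃-at-x) ⟨
      A + (B + (C + X))         ∎

    A≤Δ : A ≤ Δ
    A≤Δ = ≤-trans (length-edgesAt≤degree a [] (λ ()) S-unique S-edges (λ _ ())) (degree≤maxDegree a)

    1+B≤Δ : suc B ≤ Δ
    1+B≤Δ = ≤-trans (length-edgesAt≤degree b ([] ∷ []) (λ { (here refl) → Adj-sym a~b }) S₁-unique S₁-edges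
                       (λ { e∈S₁ (here refl) → proj₂ (S₁⊆ e∈S₁) }))
                    (degree≤maxDegree b)

    2+C≤Δ : suc (suc C) ≤ Δ
    2+C≤Δ = ≤-trans (length-edgesAt≤degree c ((Adj⇒≢ a~b ∷ []) ∷ [] ∷ [])
                       (λ { (here refl) → Adj-sym a~c ; (there (here refl)) → Adj-sym b~c })
                       S₂-unique S₂-edges
                       (λ { e∈S₂ (here refl)         → proj₂ (S₁⊆ (proj₁ (S₂⊆ e∈S₂)))
                          ; e∈S₂ (there (here refl)) → proj₂ (S₂⊆ e∈S₂) }))
                    (degree≤maxDegree c)

    X≤Δ : X ≤ Δ
    X≤Δ = ≤-trans (length-edgesAt≤degree x [] (λ ()) S₃-unique S₃-edges (λ _ ())) (degree≤maxDegree x)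

  C3-hub : C5Free G → ∀ {S} → All (IsEdge G) S → (∀ e f → e ∈ S → f ∈ S → Dist≤2 G e f) →
           ∀ {a b c} → (a , b) ∈ₑ S → (b , c) ∈ₑ S → (a , c) ∈ₑ S →
           ∃[ x ] ∀ {e} → e ∈ S → ¬ Endpoint G a e → ¬ Endpoint G b e → ¬ Endpoint G c e → Endpoint G x e
  C3-hub C5-free {S} S-edges S-dist {a} {b} {c} ab∈S bc∈S ac∈S =
    let x , at-x = triangle-hub S-edges S-dist sides
    in  x , λ e∈S ¬a ¬b ¬c → at-x e∈S λ { 0F → ¬a ; 1F → ¬b ; 2F → ¬c }
    where
    t : Fin 3 → Fin n
    t 0F = a
    t 1F = b
    t 2F = c

    t-adj : ∀ {i j} → i ≢ j → Adj G (t i) (t j)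
    t-adj {0F} {1F} _ = ∈ₑ⇒Adj S-edges ab∈S
    t-adj {1F} {2F} _ = ∈ₑ⇒Adj S-edges bc∈S
    t-adj {0F} {2F} _ = ∈ₑ⇒Adj S-edges ac∈S
    t-adj {1F} {0F} _ = Adj-sym (∈ₑ⇒Adj S-edges ab∈S)
    t-adj {2F} {1F} _ = Adj-sym (∈ₑ⇒Adj S-edges bc∈S)
    t-adj {2F} {0F} _ = Adj-sym (∈ₑ⇒Adj S-edges ac∈S)
    t-adj {0F} {0F} i≢i = contradiction refl i≢i
    t-adj {1F} {1F} i≢i = contradiction refl i≢i
    t-adj {2F} {2F} i≢i = contradiction refl i≢i

    open Triangle {G = G} C5-free t t-adj

    side : ∀ {i j} k → (t i , t j) ∈ₑ S → i ≢ k → j ≢ k → ∃[ e ] e ∈ S × Opposite k e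
    side k titj∈S i≢k j≢k =
      let e , e∈S , e⊆ = ∈ₑ⇒⊆ᵛ titj∈S
      in  e , e∈S , λ z∈e → [ (λ z≡ti → _ , i≢k , z≡ti) , (λ z≡tj → _ , j≢k , z≡tj) ] (e⊆ z∈e)

    sides : ∀ k → ∃[ e ] e ∈ S × Opposite k e
    sides 0F = side {1F} {2F} 0F bc∈S (λ ()) (λ ())
    sides 1F = side {0F} {2F} 1F ac∈S (λ ()) (λ ())
    sides 2F = side {0F} {1F} 2F ab∈S (λ ()) (λ ())

lemma3p2 : {n : ℕ} (G : Graph n) → C5Free G → 1 ≤ maxDegree G →
    (S : List (Fin n × Fin n)) → MaxStrongClique G S → InducedHasC3 S →
    length S ≤ 4 * maxDegree G ∸ 3
lemma3p2 G C5-free _ S ((S-unique , S-edges , S-dist) , _) (a , b , c , ab∈S , bc∈S , ac∈S) =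
  let x , at-x = C3-hub G C5-free S-edges S-dist ab∈S bc∈S ac∈S
  in  triangle-cover-bound G S-unique S-edges (∈ₑ⇒Adj S-edges ab∈S) (∈ₑ⇒Adj S-edges ac∈S)
                           (∈ₑ⇒Adj S-edges bc∈S) at-x
  where open GraphProperties G
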